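{- Let $G=(V,E)$ be a connected graph with $n$ vertices, diameter $d$, and nonsingular distance matrix $\mathbf{D}$, and let $k\ge1$. Then the metric dimension of the $k$-supertoken graph satisfies $\dim(\mathcal{F}_k(G))\le |V|$. Moreover, if in addition $G$ is degree-regular, then $\dim(\mathcal{F}_k(G))\le |V|-1$.
   Context: For a graph $G$ with vertex set $\{1,\ldots,n\}$ and $k\ge1$, the $k$-supertoken graph $\mathcal{F}_k(G)$ has as vertices all vectors $\mathbf{x}=(x_1,\ldots,x_n)$ of nonnegative integers with $\sum_i x_i=k$, with $\mathbf{x},\mathbf{y}$ adjacent iff $\mathbf{y}=\mathbf{x}-\mathbf{e}_i+\mathbf{e}_j$ for some edge $\{i,j\}$ of $G$ with $x_i\ge1$. The distance matrix $\mathbf{D}$ of $G$ has entries $\operatorname{dist}_G(i,j)$. $G$ is degree-regular if for each $i$ the number of vertices at distance exactly $i$ from a vertex $u$ does not depend on $u$. A vertex subset $C=\{z_1,\ldots,z_c\}$ is a resolving set if every vertex $u$ is uniquely determined by $(\operatorname{dist}(u,z_1),\ldots,\operatorname{dist}(u,z_c))$; the metric dimension is the minimum size of a resolving set. -}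

module Defs where

open import Data.Nat using (ℕ; zero; suc; _+_; _≤_; pred)
open import Data.Nat.Properties using (_≟_)
open import Data.Integer as ℤ using (ℤ; +_; -_)
open import Data.Fin using (Fin; zero; suc; toℕ; punchIn)
open import Data.Vec using (Vec; lookup; sum; updateAt)
open import Data.List using (List; length)
open import Data.List.Membership.Propositional using (_∈_)
open import Data.Product using (Σ; ∃; ∃-syntax; _×_; _,_; proj₁)
open import Relation.Nullary using (¬_; does)
open import Relation.Binary.PropositionalEquality using (_≡_)
open import Level using (0ℓ) renaming (suc to lsuc)

record Graph (n : ℕ) : Set₁ where
  field
    E      : Fin n → Fin n → Set
    E-sym  : ∀ {i j} → E i j → E j i
    E-irr  : ∀ {i} → ¬ E i i
open Graph public

data Walk {V : Set} (Adj : V → V → Set) : V → V → ℕ → Set where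
  here : ∀ {x} → Walk Adj x x 0
  step : ∀ {x y z m} → Adj x y → Walk Adj y z m → Walk Adj x z (suc m)

Dist : {V : Set} (Adj : V → V → Set) → V → V → ℕ → Set
Dist Adj x y m = Walk Adj x y m × (∀ m′ → Walk Adj x y m′ → m ≤ m′)

Connected : {V : Set} (Adj : V → V → Set) → Set
Connected Adj = ∀ x y → ∃[ m ] Walk Adj x y m

SameDist : {V : Set} (Adj : V → V → Set) → V → V → V → Set
SameDist Adj u v z = ∃[ m ] (Dist Adj u z m × Dist Adj v z m)

Resolving : {V : Set} (Eqv : V → V → Set) (Adj : V → V → Set) → List V → Set
Resolving Eqv Adj C = ∀ u v → (∀ {z} → z ∈ C → SameDist Adj u v z) → Eqv u v

MetricDimLE : {V : Set} (Eqv : V → V → Set) (Adj : V → V → Set) → ℕ → Set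
MetricDimLE Eqv Adj b = ∃[ C ] (length C ≤ b × Resolving Eqv Adj C)

IsDistMatrix : ∀ {n} → Graph n → (Fin n → Fin n → ℕ) → Set
IsDistMatrix G D = ∀ i j → Dist (E G) i j (D i j)

sumFin : ∀ {n} → (Fin n → ℤ) → ℤ
sumFin {zero}  f = + 0
sumFin {suc n} f = f zero ℤ.+ sumFin (λ i → f (suc i))

sign : ℕ → ℤ
sign zero          = + 1
sign (suc zero)    = - (+ 1)
sign (suc (suc m)) = sign m

det : ∀ {n} → (Fin n → Fin n → ℤ) → ℤ
det {zero}  M = + 1
det {suc n} M = sumFin λ j →
  sign (toℕ j) ℤ.* (M zero j ℤ.* det (λ a b → M (suc a) (punchIn j b)))

countFin : ∀ {n} → (Fin n → ℕ) → ℕ → ℕ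
countFin {zero}  f i = 0
countFin {suc n} f i =
  (if does (f zero ≟ i) then 1 else 0) + countFin (λ j → f (suc j)) i
  where open import Data.Bool using (if_then_else_)

DegreeRegular : ∀ {n} → (Fin n → Fin n → ℕ) → Set
DegreeRegular D = ∀ u v i → countFin (D u) i ≡ countFin (D v) i

STVertex : ℕ → ℕ → Set
STVertex n k = Σ (Vec ℕ n) λ x → sum x ≡ k

STAdj : ∀ {n} → Graph n → (k : ℕ) → STVertex n k → STVertex n k → Set
STAdj G k (x , _) (y , _) =
  ∃[ i ] ∃[ j ] (E G i j × 1 ≤ lookup x i ×
                 y ≡ updateAt (updateAt x i pred) j suc)

STEq : ∀ {n k} → STVertex n k → STVertex n k → Set
STEq (x , _) (y , _) = x ≡ y

module Submission where

-- In the k-supertoken graph the distance from a configuration x to the configuration k eᵢ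
-- (all tokens on i) is Σⱼ xⱼ d(j,i) = (xD)ᵢ: a move changes this sum by at most one, and
-- moving a token that is not on i one step along a shortest path towards i lowers it by one.
-- So the distances to the n configurations k eᵢ determine xD, hence x, because the rows of
-- D are linearly independent when det D ≠ 0. If G is degree-regular, all rows of D have the
-- same sum r, so the coordinates of xD add up to k r and the distance to k e₀ is redundant.

open import Defs
open import Data.Nat using (ℕ; _≤_; _∸_)
open import Data.Integer using (+_)
open import Data.Fin using (Fin)
open import Data.Product using (_×_)
open import Relation.Binary.PropositionalEquality using (_≢_)

module Determinant where

  open import Data.Nat using (zero; suc)
  open import Data.Integer using (ℤ; -_; _+_; _*_; 0ℤ; 1ℤ; -1ℤ)
  import Data.Integer.Properties as ℤ
  open import Data.Integer.Tactic.RingSolver using (solve-∀)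
  open import Algebra.Properties.Semiring.Sum ℤ.+-*-semiring
    using (sum; sum-syntax; sum-cong-≗; sum-remove; sum-replicate-zero; ∑-comm; *-distribˡ-sum)
  open import Data.Fin using (zero; suc; toℕ; punchIn; punchOut; _≟_)
  open import Data.Fin.Properties using (punchInᵢ≢i; punchOut-cong; punchOut-punchIn)
  open import Data.Vec.Functional using (updateAt; tail)
  open import Data.Vec.Functional.Properties
    using (updateAt-updates; updateAt-minimal; updateAt-id-local; map-updateAt-local)
  open import Data.Sum using (inj₁; inj₂)
  open import Data.Empty using (⊥-elim)
  open import Function using (_∘_; const)
  open import Relation.Nullary using (yes; no)
  open import Relation.Binary.PropositionalEquality
  open ≡-Reasoning

  Matrix : ℕ → Set
  Matrix n = Fin n → Fin n → ℤ

  sgn : ∀ {n} → Fin n → ℤ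
  sgn j = sign (toℕ j)

  minor : ∀ {n} → Fin (suc n) → Matrix (suc n) → Matrix n
  minor j M a b = M (suc a) (punchIn j b)

  _[_]≔_ : ∀ {n} → Matrix n → Fin n → (Fin n → ℤ) → Matrix n
  M [ i ]≔ r = updateAt M i (const r)

  sumFin≡sum : ∀ {n} (f : Fin n → ℤ) → sumFin f ≡ sum f
  sumFin≡sum {zero}  f = refl
  sumFin≡sum {suc n} f = cong (_+_ (f zero)) (sumFin≡sum (f ∘ suc))

  ∑-zero : ∀ {n} {f : Fin n → ℤ} → (∀ i → f i ≡ 0ℤ) → sum f ≡ 0ℤ
  ∑-zero {n} f≗0 = trans (sum-cong-≗ f≗0) (sum-replicate-zero n)

  ∑-neg : ∀ {n} (f : Fin n → ℤ) → ∑[ i < n ] (- f i) ≡ - sum f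
  ∑-neg f = begin
    ∑[ i < _ ] (- f i)    ≡⟨ sum-cong-≗ (sym ∘ ℤ.-1*i≡-i ∘ f) ⟩
    ∑[ i < _ ] (-1ℤ * f i)  ≡⟨ *-distribˡ-sum -1ℤ f ⟨
    -1ℤ * sum f           ≡⟨ ℤ.-1*i≡-i (sum f) ⟩
    - sum f               ∎

  *-*-distribˡ-sum : ∀ {n} s t (f : Fin n → ℤ) → s * (t * sum f) ≡ ∑[ i < n ] (s * (t * f i))
  *-*-distribˡ-sum s t f = trans (cong (s *_) (*-distribˡ-sum t f)) (*-distribˡ-sum s (λ i → t * f i))

  ∑-comm-factor : ∀ {m n} (w : Fin m → ℤ) (F : Fin n → Fin m → ℤ) →
    ∑[ j < n ] ∑[ l < m ] (w l * F j l) ≡ ∑[ l < m ] (w l * ∑[ j < n ] F j l)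
  ∑-comm-factor w F = trans (∑-comm (λ j l → w l * F j l))
    (sum-cong-≗ λ l → sym (*-distribˡ-sum (w l) (λ j → F j l)))

  i≡-i⇒i≡0 : ∀ {x} → x ≡ - x → x ≡ 0ℤ
  i≡-i⇒i≡0 {x} x≡-x with ℤ.i*j≡0⇒i≡0∨j≡0 (1ℤ + 1ℤ) 2x≡0
    where
    double : ∀ y → (1ℤ + 1ℤ) * y ≡ y + y
    double = solve-∀
    2x≡0 : (1ℤ + 1ℤ) * x ≡ 0ℤ
    2x≡0 = trans (double x) (trans (cong (_+_ x) x≡-x) (ℤ.+-inverseʳ x))
  ... | inj₂ x≡0 = x≡0

  det-expand : ∀ {n} (M : Matrix (suc n)) →
    det M ≡ ∑[ j < suc n ] (sgn j * (M zero j * det (minor j M)))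
  det-expand M = sumFin≡sum (λ j → sgn j * (M zero j * det (minor j M)))

  det-cong : ∀ {n} {M N : Matrix n} → (∀ i j → M i j ≡ N i j) → det M ≡ det N
  det-cong {zero}  _ = refl
  det-cong {suc n} {M} {N} M≐N = begin
    det M                                             ≡⟨ det-expand M ⟩
    ∑[ j < suc n ] (sgn j * (M zero j * det (minor j M))) ≡⟨ sum-cong-≗ (λ j →
       cong₂ (λ x d → sgn j * (x * d)) (M≐N zero j) (det-cong (λ a b → M≐N (suc a) (punchIn j b)))) ⟩
    ∑[ j < suc n ] (sgn j * (N zero j * det (minor j N))) ≡⟨ det-expand N ⟨
    det N                                             ∎

  minor-[]≔ : ∀ {n} (j : Fin (suc (suc n))) (M : Matrix (suc (suc n))) i r a b →
    minor j (M [ suc i ]≔ r) a b ≡ (minor j M [ i ]≔ (r ∘ punchIn j)) a b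
  minor-[]≔ j M i r a b =
    cong (λ row → row b) (map-updateAt-local {f = _∘ punchIn j} {g = const r} (tail M) i refl a)

  det-[suc]≔ : ∀ {n} (M : Matrix (suc (suc n))) i r →
    det (M [ suc i ]≔ r) ≡ ∑[ j < suc (suc n) ] (sgn j * (M zero j * det (minor j M [ i ]≔ (r ∘ punchIn j))))
  det-[suc]≔ M i r = trans (det-expand (M [ suc i ]≔ r))
    (sum-cong-≗ λ j → cong (λ d → sgn j * (M zero j * d)) (det-cong (minor-[]≔ j M i r)))

  det-linear : ∀ {n m} (i : Fin n) (M : Matrix n) (w : Fin m → ℤ) (R : Fin m → Fin n → ℤ) →
    det (M [ i ]≔ (λ c → ∑[ l < m ] (w l * R l c))) ≡ ∑[ l < m ] (w l * det (M [ i ]≔ R l))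
  det-linear {suc n} {m} zero M w R = begin
    det (M [ zero ]≔ (λ c → ∑[ l < m ] (w l * R l c)))
      ≡⟨ det-expand (M [ zero ]≔ (λ c → ∑[ l < m ] (w l * R l c))) ⟩
    ∑[ j < suc n ] (sgn j * ((∑[ l < m ] (w l * R l j)) * C j))
      ≡⟨ sum-cong-≗ (λ j → trans (cong (sgn j *_) (ℤ.*-comm _ (C j)))
                          (*-*-distribˡ-sum (sgn j) (C j) (λ l → w l * R l j))) ⟩
    ∑[ j < suc n ] ∑[ l < m ] (sgn j * (C j * (w l * R l j)))
      ≡⟨ sum-cong-≗ (λ j → sum-cong-≗ (λ l → regroup (sgn j) (C j) (w l) (R l j))) ⟩
    ∑[ j < suc n ] ∑[ l < m ] (w l * (sgn j * (R l j * C j)))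
      ≡⟨ ∑-comm-factor w (λ j l → sgn j * (R l j * C j)) ⟩
    ∑[ l < m ] (w l * ∑[ j < suc n ] (sgn j * (R l j * C j)))
      ≡⟨ sum-cong-≗ (λ l → cong (w l *_) (det-expand (M [ zero ]≔ R l))) ⟨
    ∑[ l < m ] (w l * det (M [ zero ]≔ R l))
      ∎
    where
    C : Fin (suc n) → ℤ
    C j = det (minor j M)
    regroup : ∀ s c x r → s * (c * (x * r)) ≡ x * (s * (r * c))
    regroup = solve-∀
  det-linear {suc (suc n)} {m} (suc i) M w R = begin
    det (M [ suc i ]≔ (λ c → ∑[ l < m ] (w l * R l c)))
      ≡⟨ det-[suc]≔ M i _ ⟩
    ∑[ j < suc (suc n) ]
      (sgn j * (M zero j * det (minor j M [ i ]≔ (λ c → ∑[ l < m ] (w l * R l (punchIn j c))))))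
      ≡⟨ sum-cong-≗ (λ j → cong (λ d → sgn j * (M zero j * d))
                            (det-linear i (minor j M) w (λ l → R l ∘ punchIn j))) ⟩
    ∑[ j < suc (suc n) ] (sgn j * (M zero j * ∑[ l < m ] (w l * C j l)))
      ≡⟨ sum-cong-≗ (λ j → trans (*-*-distribˡ-sum (sgn j) (M zero j) (λ l → w l * C j l))
                            (sum-cong-≗ (λ l → regroup (sgn j) (M zero j) (w l) (C j l)))) ⟩
    ∑[ j < suc (suc n) ] ∑[ l < m ] (w l * (sgn j * (M zero j * C j l)))
      ≡⟨ ∑-comm-factor w (λ j l → sgn j * (M zero j * C j l)) ⟩
    ∑[ l < m ] (w l * ∑[ j < suc (suc n) ] (sgn j * (M zero j * C j l)))
      ≡⟨ sum-cong-≗ (λ l → cong (w l *_) (det-[suc]≔ M i (R l))) ⟨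
    ∑[ l < m ] (w l * det (M [ suc i ]≔ R l))
      ∎
    where
    C : Fin (suc (suc n)) → Fin m → ℤ
    C j l = det (minor j M [ i ]≔ (R l ∘ punchIn j))
    regroup : ∀ s x y d → s * (x * (y * d)) ≡ y * (s * (x * d))
    regroup = solve-∀

  det-zero-row : ∀ {n} (i : Fin n) (M : Matrix n) → det (M [ i ]≔ const 0ℤ) ≡ 0ℤ
  det-zero-row i M = det-linear {m = 0} i M (λ ()) (λ ())

  swap₀₁ : ∀ {n} → Matrix (suc (suc n)) → Matrix (suc (suc n))
  swap₀₁ M zero          = M (suc zero)
  swap₀₁ M (suc zero)    = M zero
  swap₀₁ M (suc (suc i)) = M (suc (suc i))

  sign-suc : ∀ m → sign (suc m) ≡ - sign m
  sign-suc zero          = refl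
  sign-suc (suc zero)    = refl
  sign-suc (suc (suc m)) = sign-suc m

  sgn-punchOut-anti : ∀ {n} {a b : Fin (suc (suc n))} (a≢b : a ≢ b) (b≢a : b ≢ a) →
    sgn a * sgn (punchOut a≢b) ≡ - (sgn b * sgn (punchOut b≢a))
  sgn-punchOut-anti {a = zero} {zero} a≢b _ = ⊥-elim (a≢b refl)
  sgn-punchOut-anti {a = zero} {suc b} _ _ = begin
    1ℤ * sgn b              ≡⟨ ring (sgn b) ⟩
    - ((- sgn b) * 1ℤ)      ≡⟨ cong (λ s → - (s * 1ℤ)) (sign-suc (toℕ b)) ⟨
    - (sgn (suc b) * 1ℤ)    ∎
    where
    ring : ∀ s → 1ℤ * s ≡ - ((- s) * 1ℤ)
    ring = solve-∀
  sgn-punchOut-anti {a = suc a} {zero} _ _ = begin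
    sgn (suc a) * 1ℤ        ≡⟨ cong (_* 1ℤ) (sign-suc (toℕ a)) ⟩
    (- sgn a) * 1ℤ          ≡⟨ ring (sgn a) ⟩
    - (1ℤ * sgn a)          ∎
    where
    ring : ∀ s → (- s) * 1ℤ ≡ - (1ℤ * s)
    ring = solve-∀
  sgn-punchOut-anti {zero} {suc zero} {suc zero} a≢b _ = ⊥-elim (a≢b refl)
  sgn-punchOut-anti {suc n} {suc a} {suc b} a≢b b≢a = begin
    sgn (suc a) * sgn (suc p)            ≡⟨ cong₂ _*_ (sign-suc (toℕ a)) (sign-suc (toℕ p)) ⟩
    (- sgn a) * (- sgn p)                ≡⟨ neg*neg (sgn a) (sgn p) ⟩
    sgn a * sgn p                        ≡⟨ sgn-punchOut-anti (a≢b ∘ cong suc) (b≢a ∘ cong suc) ⟩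
    - (sgn b * sgn q)                    ≡⟨ cong -_ (neg*neg (sgn b) (sgn q)) ⟨
    - ((- sgn b) * (- sgn q))
      ≡⟨ cong₂ (λ x y → - (x * y)) (sign-suc (toℕ b)) (sign-suc (toℕ q)) ⟨
    - (sgn (suc b) * sgn (suc q))        ∎
    where
    p = punchOut (a≢b ∘ cong suc)
    q = punchOut (b≢a ∘ cong suc)
    neg*neg : ∀ x y → (- x) * (- y) ≡ x * y
    neg*neg = solve-∀

  punchIn₂-comm : ∀ {n} {a b : Fin (suc (suc n))} (a≢b : a ≢ b) (b≢a : b ≢ a) (y : Fin n) →
    punchIn a (punchIn (punchOut a≢b) y) ≡ punchIn b (punchIn (punchOut b≢a) y)
  punchIn₂-comm {a = zero}  {zero}  a≢b _ y = ⊥-elim (a≢b refl)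
  punchIn₂-comm {a = zero}  {suc b} _   _ y = refl
  punchIn₂-comm {a = suc a} {zero}  _   _ y = refl
  punchIn₂-comm {suc n} {suc a} {suc b} _ _ zero = refl
  punchIn₂-comm {suc n} {suc a} {suc b} a≢b b≢a (suc y) =
    cong suc (punchIn₂-comm (a≢b ∘ cong suc) (b≢a ∘ cong suc) y)

  -- The term of the expansion of det M along its first two rows that uses columns a and b.
  pairTerm : ∀ {n} → Matrix (suc (suc n)) → (a b : Fin (suc (suc n))) → ℤ
  pairTerm M a b with a ≟ b
  ... | yes _  = 0ℤ
  ... | no a≢b = (sgn a * sgn (punchOut a≢b)) *
                 ((M zero a * M (suc zero) b) * det (minor (punchOut a≢b) (minor a M)))

  pairTerm-diag : ∀ {n} (M : Matrix (suc (suc n))) a → pairTerm M a a ≡ 0ℤ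
  pairTerm-diag M a with a ≟ a
  ... | yes _   = refl
  ... | no a≢a  = ⊥-elim (a≢a refl)

  pairTerm-punchIn : ∀ {n} (M : Matrix (suc (suc n))) a l →
    pairTerm M a (punchIn a l) ≡
    sgn a * (M zero a * (sgn l * (M (suc zero) (punchIn a l) * det (minor l (minor a M)))))
  pairTerm-punchIn M a l with a ≟ punchIn a l
  ... | yes a≡b = ⊥-elim (punchInᵢ≢i a l (sym a≡b))
  ... | no a≢b = begin
    (sgn a * sgn p) * ((M zero a * M (suc zero) (punchIn a l)) * det (minor p (minor a M)))
      ≡⟨ cong (λ p → (sgn a * sgn p) * ((M zero a * M (suc zero) (punchIn a l)) * det (minor p (minor a M))))
              (trans (punchOut-cong a refl) (punchOut-punchIn a)) ⟩
    (sgn a * sgn l) * ((M zero a * M (suc zero) (punchIn a l)) * det (minor l (minor a M)))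
      ≡⟨ regroup (sgn a) (sgn l) (M zero a) (M (suc zero) (punchIn a l)) (det (minor l (minor a M))) ⟩
    sgn a * (M zero a * (sgn l * (M (suc zero) (punchIn a l) * det (minor l (minor a M)))))
      ∎
    where
    p = punchOut a≢b
    regroup : ∀ s t x y d → (s * t) * ((x * y) * d) ≡ s * (x * (t * (y * d)))
    regroup = solve-∀

  det-expand-two-rows : ∀ {n} (M : Matrix (suc (suc n))) →
    det M ≡ ∑[ a < suc (suc n) ] ∑[ b < suc (suc n) ] pairTerm M a b
  det-expand-two-rows {n} M = begin
    det M
      ≡⟨ det-expand M ⟩
    ∑[ a < suc (suc n) ] (sgn a * (M zero a * det (minor a M)))
      ≡⟨ sum-cong-≗ (λ a → trans (cong (λ d → sgn a * (M zero a * d)) (det-expand (minor a M)))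
                                  (*-*-distribˡ-sum (sgn a) (M zero a)
                                    (λ l → sgn l * (M (suc zero) (punchIn a l) * det (minor l (minor a M)))))) ⟩
    ∑[ a < suc (suc n) ] ∑[ l < suc n ]
      (sgn a * (M zero a * (sgn l * (M (suc zero) (punchIn a l) * det (minor l (minor a M))))))
      ≡⟨ sum-cong-≗ (λ a → sum-cong-≗ (pairTerm-punchIn M a)) ⟨
    ∑[ a < suc (suc n) ] ∑[ l < suc n ] pairTerm M a (punchIn a l)
      ≡⟨ sum-cong-≗ off-diagonal ⟨
    ∑[ a < suc (suc n) ] ∑[ b < suc (suc n) ] pairTerm M a b
      ∎
    where
    off-diagonal : ∀ a → sum (pairTerm M a) ≡ ∑[ l < suc n ] pairTerm M a (punchIn a l)
    off-diagonal a = trans (sum-remove {i = a} (pairTerm M a))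
      (trans (cong (_+ ∑[ l < suc n ] pairTerm M a (punchIn a l)) (pairTerm-diag M a)) (ℤ.+-identityˡ _))

  pairTerm-swap₀₁ : ∀ {n} (M : Matrix (suc (suc n))) a b → pairTerm (swap₀₁ M) a b ≡ - pairTerm M b a
  pairTerm-swap₀₁ M a b with a ≟ b | b ≟ a
  ... | yes _   | yes _   = refl
  ... | yes a≡b | no b≢a  = ⊥-elim (b≢a (sym a≡b))
  ... | no a≢b  | yes b≡a = ⊥-elim (a≢b (sym b≡a))
  ... | no a≢b  | no b≢a  = begin
    (sgn a * sgn (punchOut a≢b)) * ((M (suc zero) a * M zero b) * det (minor (punchOut a≢b) (minor a M)))
      ≡⟨ cong₂ (λ s d → s * ((M (suc zero) a * M zero b) * d)) (sgn-punchOut-anti a≢b b≢a) minors≡ ⟩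
    (- s) * ((M (suc zero) a * M zero b) * Q)
      ≡⟨ regroup s (M (suc zero) a) (M zero b) Q ⟩
    - (s * ((M zero b * M (suc zero) a) * Q))
      ∎
    where
    s = sgn b * sgn (punchOut b≢a)
    Q = det (minor (punchOut b≢a) (minor b M))
    minors≡ : det (minor (punchOut a≢b) (minor a M)) ≡ Q
    minors≡ = det-cong (λ x y → cong (M (suc (suc x))) (punchIn₂-comm a≢b b≢a y))
    regroup : ∀ s x y d → (- s) * ((x * y) * d) ≡ - (s * ((y * x) * d))
    regroup = solve-∀

  det-swap₀₁ : ∀ {n} (M : Matrix (suc (suc n))) → det (swap₀₁ M) ≡ - det M
  det-swap₀₁ {n} M = begin
    det (swap₀₁ M)
      ≡⟨ det-expand-two-rows (swap₀₁ M) ⟩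
    ∑[ a < suc (suc n) ] ∑[ b < suc (suc n) ] pairTerm (swap₀₁ M) a b
      ≡⟨ sum-cong-≗ (λ a → trans (sum-cong-≗ (pairTerm-swap₀₁ M a))
                                  (∑-neg (λ b → pairTerm M b a))) ⟩
    ∑[ a < suc (suc n) ] (- ∑[ b < suc (suc n) ] pairTerm M b a)
      ≡⟨ ∑-neg (λ a → ∑[ b < suc (suc n) ] pairTerm M b a) ⟩
    - ∑[ a < suc (suc n) ] ∑[ b < suc (suc n) ] pairTerm M b a
      ≡⟨ cong -_ (∑-comm (λ a b → pairTerm M b a)) ⟩
    - ∑[ b < suc (suc n) ] ∑[ a < suc (suc n) ] pairTerm M b a
      ≡⟨ cong -_ (det-expand-two-rows M) ⟨
    - det M
      ∎

  det-equal-rows : ∀ {n} (M : Matrix n) {i j} → i ≢ j → (∀ c → M i c ≡ M j c) → det M ≡ 0ℤ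
  det-equal-rows-head : ∀ {n} (j : Fin n) (M : Matrix (suc n)) →
    (∀ c → M zero c ≡ M (suc j) c) → det M ≡ 0ℤ
  det-equal-rows-tail : ∀ {n} (M : Matrix (suc n)) {i j : Fin n} → i ≢ j →
    (∀ c → M (suc i) c ≡ M (suc j) c) → det M ≡ 0ℤ

  det-equal-rows M {zero}  {zero}  i≢j _     = ⊥-elim (i≢j refl)
  det-equal-rows M {zero}  {suc j} _   Mi≐Mj = det-equal-rows-head j M Mi≐Mj
  det-equal-rows M {suc i} {zero}  _   Mi≐Mj = det-equal-rows-head i M (sym ∘ Mi≐Mj)
  det-equal-rows M {suc i} {suc j} i≢j Mi≐Mj = det-equal-rows-tail M (i≢j ∘ cong suc) Mi≐Mj

  det-equal-rows-tail M i≢j Mi≐Mj = trans (det-expand M) (∑-zero λ a →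
    trans (cong (λ d → sgn a * (M zero a * d)) (det-equal-rows (minor a M) i≢j (Mi≐Mj ∘ punchIn a)))
          (annihilate (sgn a) (M zero a)))
    where
    annihilate : ∀ s x → s * (x * 0ℤ) ≡ 0ℤ
    annihilate = solve-∀

  det-equal-rows-head zero M M₀≐M₁ = i≡-i⇒i≡0 (trans (det-cong swap≐id) (det-swap₀₁ M))
    where
    swap≐id : ∀ a c → M a c ≡ swap₀₁ M a c
    swap≐id zero          c = M₀≐M₁ c
    swap≐id (suc zero)    c = sym (M₀≐M₁ c)
    swap≐id (suc (suc a)) c = refl
  -- Swapping the first two rows moves the repeated row away from row 0.
  det-equal-rows-head (suc j) M M₀≐Mⱼ = begin
    det M                 ≡⟨ ℤ.neg-involutive (det M) ⟨
    - - det M             ≡⟨ cong -_ (det-swap₀₁ M) ⟨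
    - det (swap₀₁ M)      ≡⟨ cong -_ (det-equal-rows-tail (swap₀₁ M) {zero} {suc j} (λ ()) M₀≐Mⱼ) ⟩
    - 0ℤ                  ≡⟨⟩
    0ℤ                    ∎

  []≔-cong : ∀ {n} (M : Matrix n) i {r s : Fin n → ℤ} → (∀ c → r c ≡ s c) →
    ∀ a c → (M [ i ]≔ r) a c ≡ (M [ i ]≔ s) a c
  []≔-cong M i r≐s a c with a ≟ i
  ... | yes refl = trans (cong (λ row → row c) (updateAt-updates a M))
                         (trans (r≐s c) (sym (cong (λ row → row c) (updateAt-updates a M))))
  ... | no a≢i   = trans (cong (λ row → row c) (updateAt-minimal a i M a≢i))
                         (sym (cong (λ row → row c) (updateAt-minimal a i M a≢i)))

  det-copy-row : ∀ {n} (M : Matrix n) i l → l ≢ i → det (M [ i ]≔ M l) ≡ 0ℤ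
  det-copy-row M i l l≢i = det-equal-rows (M [ i ]≔ M l) (l≢i ∘ sym) (λ c →
    trans (cong (λ row → row c) (updateAt-updates i M))
          (sym (cong (λ row → row c) (updateAt-minimal l i M l≢i))))

  det≢0⇒rows-independent : ∀ {n} (M : Matrix n) → det M ≢ 0ℤ →
    (w : Fin n → ℤ) → (∀ c → ∑[ j < n ] (w j * M j c) ≡ 0ℤ) → ∀ i → w i ≡ 0ℤ
  det≢0⇒rows-independent {suc n} M det≢0 w wM≡0 i with ℤ.i*j≡0⇒i≡0∨j≡0 (w i) wᵢdet≡0
    where
    wᵢdet≡0 : w i * det M ≡ 0ℤ
    wᵢdet≡0 = begin
      w i * det M
        ≡⟨ cong (w i *_) (det-cong (λ a c → cong (λ row → row c) (updateAt-id-local i M refl a))) ⟨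
      w i * det (M [ i ]≔ M i)
        ≡⟨ ℤ.+-identityʳ _ ⟨
      w i * det (M [ i ]≔ M i) + 0ℤ
        ≡⟨ cong (_+_ (w i * det (M [ i ]≔ M i))) (∑-zero (λ l →
             trans (cong (w (punchIn i l) *_) (det-copy-row M i (punchIn i l) (punchInᵢ≢i i l)))
                   (ℤ.*-zeroʳ (w (punchIn i l))))) ⟨
      w i * det (M [ i ]≔ M i) + ∑[ l < n ] (w (punchIn i l) * det (M [ i ]≔ M (punchIn i l)))
        ≡⟨ sum-remove {i = i} (λ l → w l * det (M [ i ]≔ M l)) ⟨
      ∑[ l < suc n ] (w l * det (M [ i ]≔ M l))
        ≡⟨ det-linear i M w M ⟨
      det (M [ i ]≔ (λ c → ∑[ l < suc n ] (w l * M l c)))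
        ≡⟨ det-cong ([]≔-cong M i wM≡0) ⟩
      det (M [ i ]≔ const 0ℤ)
        ≡⟨ det-zero-row i M ⟩
      0ℤ
        ∎
  ... | inj₁ wᵢ≡0  = wᵢ≡0
  ... | inj₂ det≡0 = ⊥-elim (det≢0 det≡0)

module TokenVectors where

  open import Data.Nat using (zero; suc; _+_; _*_; pred)
  import Data.Nat.Properties as ℕ
  open import Data.Nat.Tactic.RingSolver using (solve-∀)
  open import Data.Fin using (zero; suc)
  open import Data.Fin.Properties using (suc-injective)
  open import Data.Vec using (Vec; []; _∷_; lookup; sum; updateAt; replicate)
  open import Function using (_∘_)
  open import Relation.Binary.PropositionalEquality

  dot : ∀ {n} → Vec ℕ n → (Fin n → ℕ) → ℕ
  dot []      w = 0
  dot (a ∷ x) w = a * w zero + dot x (w ∘ suc)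

  private
    swap-+ : ∀ x y z → x + (y + z) ≡ y + (x + z)
    swap-+ = solve-∀

  dot-cong : ∀ {n} (x : Vec ℕ n) {w w′ : Fin n → ℕ} → (∀ j → w j ≡ w′ j) → dot x w ≡ dot x w′
  dot-cong []      _    = refl
  dot-cong (a ∷ x) w≐w′ = cong₂ (λ s t → a * s + t) (w≐w′ zero) (dot-cong x (w≐w′ ∘ suc))

  dot-updateAt-suc : ∀ {n} (x : Vec ℕ n) a w → dot (updateAt x a suc) w ≡ w a + dot x w
  dot-updateAt-suc (x₀ ∷ x) zero    w = ℕ.+-assoc (w zero) (x₀ * w zero) (dot x (w ∘ suc))
  dot-updateAt-suc (x₀ ∷ x) (suc a) w =
    trans (cong (_+_ (x₀ * w zero)) (dot-updateAt-suc x a (w ∘ suc)))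
          (swap-+ (x₀ * w zero) (w (suc a)) (dot x (w ∘ suc)))

  dot-updateAt-pred : ∀ {n} (x : Vec ℕ n) a w → 1 ≤ lookup x a →
    w a + dot (updateAt x a pred) w ≡ dot x w
  dot-updateAt-pred (suc x₀ ∷ x) zero    w _  = sym (ℕ.+-assoc (w zero) (x₀ * w zero) (dot x (w ∘ suc)))
  dot-updateAt-pred (x₀ ∷ x)     (suc a) w xₐ≥1 =
    trans (swap-+ (w (suc a)) (x₀ * w zero) (dot (updateAt x a pred) (w ∘ suc)))
          (cong (_+_ (x₀ * w zero)) (dot-updateAt-pred x a (w ∘ suc) xₐ≥1))

  sum-updateAt-suc : ∀ {n} (x : Vec ℕ n) a → sum (updateAt x a suc) ≡ suc (sum x)
  sum-updateAt-suc (x₀ ∷ x) zero    = refl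
  sum-updateAt-suc (x₀ ∷ x) (suc a) = trans (cong (_+_ x₀) (sum-updateAt-suc x a)) (ℕ.+-suc x₀ (sum x))

  sum-updateAt-pred : ∀ {n} (x : Vec ℕ n) a → 1 ≤ lookup x a → suc (sum (updateAt x a pred)) ≡ sum x
  sum-updateAt-pred (suc x₀ ∷ x) zero    _    = refl
  sum-updateAt-pred (x₀ ∷ x)     (suc a) xₐ≥1 =
    trans (sym (ℕ.+-suc x₀ _)) (cong (_+_ x₀) (sum-updateAt-pred x a xₐ≥1))

  concentrated : ∀ {n} → Fin n → ℕ → Vec ℕ n
  concentrated zero    k = k ∷ replicate _ 0
  concentrated (suc i) k = 0 ∷ concentrated i k

  sum-replicate-0 : ∀ n → sum (replicate n 0) ≡ 0
  sum-replicate-0 zero    = refl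
  sum-replicate-0 (suc n) = sum-replicate-0 n

  dot-replicate-0 : ∀ {n} (w : Fin n → ℕ) → dot (replicate n 0) w ≡ 0
  dot-replicate-0 {zero}  w = refl
  dot-replicate-0 {suc n} w = dot-replicate-0 (w ∘ suc)

  sum-concentrated : ∀ {n} (i : Fin n) k → sum (concentrated i k) ≡ k
  sum-concentrated {suc n} zero    k = trans (cong (_+_ k) (sum-replicate-0 n)) (ℕ.+-identityʳ k)
  sum-concentrated         (suc i) k = sum-concentrated i k

  dot-concentrated : ∀ {n} (i : Fin n) k w → dot (concentrated i k) w ≡ k * w i
  dot-concentrated zero    k w = trans (cong (_+_ (k * w zero)) (dot-replicate-0 (w ∘ suc))) (ℕ.+-identityʳ _)
  dot-concentrated (suc i) k w = dot-concentrated i k (w ∘ suc)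

  replicate-0-unique : ∀ {n} (x : Vec ℕ n) → (∀ a → lookup x a ≡ 0) → x ≡ replicate n 0
  replicate-0-unique []       _    = refl
  replicate-0-unique (x₀ ∷ x) x≐0 = cong₂ _∷_ (x≐0 zero) (replicate-0-unique x (x≐0 ∘ suc))

  concentrated-unique : ∀ {n} (x : Vec ℕ n) i → (∀ a → a ≢ i → lookup x a ≡ 0) →
    x ≡ concentrated i (sum x)
  concentrated-unique {suc n} (x₀ ∷ x) zero off with replicate-0-unique x (λ a → off (suc a) λ ())
  ... | refl = cong (_∷ replicate _ 0)
                 (sym (trans (cong (_+_ x₀) (sum-replicate-0 n)) (ℕ.+-identityʳ x₀)))
  concentrated-unique (x₀ ∷ x) (suc i) off with off zero (λ ())
  ... | refl = cong (0 ∷_) (concentrated-unique x i (λ a a≢i → off (suc a) (a≢i ∘ suc-injective)))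

module Supertoken {n} (G : Graph n) (D : Fin n → Fin n → ℕ) (D-dist : IsDistMatrix G D) (k : ℕ) where

  open import Data.Nat using (zero; suc; _+_; _*_; _<_; z≤n; s≤s; pred; _≤?_)
  import Data.Nat.Properties as ℕ
  open import Data.Nat.Induction using (<-wellFounded)
  open import Induction.WellFounded using (Acc; acc)
  open import Data.Fin using (_≟_)
  open import Data.Fin.Properties using (any?)
  open import Data.Vec using (lookup; sum; updateAt)
  open import Data.Product using (∃-syntax; _,_; proj₁; proj₂)
  open import Data.Sum using (_⊎_; inj₁; inj₂)
  open import Data.Empty using (⊥-elim)
  open import Relation.Nullary using (yes; no; ¬?)
  open import Relation.Nullary.Decidable using (_×-dec_)
  open import Relation.Binary.PropositionalEquality

  open TokenVectors

  Vertex : Set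
  Vertex = STVertex n k

  _~_ : Vertex → Vertex → Set
  _~_ = STAdj G k

  cost : Vertex → Fin n → ℕ
  cost (x , _) i = dot x (λ j → D j i)

  pile : Fin n → Vertex
  pile i = concentrated i k , sum-concentrated i k

  ≡-Vertex : {x y : Vertex} → proj₁ x ≡ proj₁ y → x ≡ y
  ≡-Vertex {x , _} {.x , _} refl = cong (x ,_) (ℕ.≡-irrelevant _ _)

  D-self : ∀ i → D i i ≡ 0
  D-self i = ℕ.n≤0⇒n≡0 (proj₂ (D-dist i i) 0 here)

  D-edge : ∀ {a b} i → E G a b → D a i ≤ suc (D b i)
  D-edge {a} {b} i e = proj₂ (D-dist a i) (suc (D b i)) (step e (proj₁ (D-dist b i)))

  cost-step : ∀ {x y} i → x ~ y → cost x i ≤ suc (cost y i)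
  cost-step {x , _} i (a , b , e , xₐ≥1 , refl) = begin
    dot x d                                  ≡⟨ dot-updateAt-pred x a d xₐ≥1 ⟨
    D a i + dot x′ d                         ≤⟨ ℕ.+-monoˡ-≤ (dot x′ d) (D-edge i e) ⟩
    suc (D b i + dot x′ d)                   ≡⟨ cong suc (dot-updateAt-suc x′ b d) ⟨
    suc (dot (updateAt x′ b suc) d)          ∎
    where
    open ℕ.≤-Reasoning
    d = λ j → D j i
    x′ = updateAt x a pred

  cost-walk : ∀ {x y m} i → Walk _~_ x y m → cost x i ≤ m + cost y i
  cost-walk i here            = ℕ.≤-refl
  cost-walk {x} i (step {y = y} x~y walk) =
    ℕ.≤-trans (cost-step {x} {y} i x~y) (s≤s (cost-walk i walk))

  shortest-path-step : ∀ {a i} → a ≢ i → ∃[ b ] (E G a b × suc (D b i) ≤ D a i)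
  shortest-path-step {a} {i} a≢i with D a i | proj₁ (D-dist a i)
  ... | _     | here              = ⊥-elim (a≢i refl)
  ... | suc d | step {y = b} e walk = b , e , s≤s (proj₂ (D-dist b i) d walk)

  descend : ∀ i x → x ≡ pile i ⊎ ∃[ y ] (x ~ y × cost y i < cost x i)
  descend i (x , Σx≡k) with any? (λ a → (1 ≤? lookup x a) ×-dec ¬? (a ≟ i))
  ... | yes (a , xₐ≥1 , a≢i) with shortest-path-step a≢i
  ...   | b , e , Dbi<Dai = inj₂ ((y , Σy≡k) , (a , b , e , xₐ≥1 , refl) , cost-drop)
    where
    open ℕ.≤-Reasoning
    d = λ j → D j i
    x′ = updateAt x a pred
    y = updateAt x′ b suc
    Σy≡k : sum y ≡ k
    Σy≡k = trans (sum-updateAt-suc x′ b) (trans (sum-updateAt-pred x a xₐ≥1) Σx≡k)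
    cost-drop : suc (dot y d) ≤ dot x d
    cost-drop = begin
      suc (dot y d)            ≡⟨ cong suc (dot-updateAt-suc x′ b d) ⟩
      suc (D b i + dot x′ d)   ≤⟨ ℕ.+-monoˡ-≤ (dot x′ d) Dbi<Dai ⟩
      D a i + dot x′ d         ≡⟨ dot-updateAt-pred x a d xₐ≥1 ⟩
      dot x d                  ∎
  descend i (x , Σx≡k) | no ∄a =
    inj₁ (≡-Vertex (trans (concentrated-unique x i off) (cong (concentrated i) Σx≡k)))
    where
    off : ∀ a → a ≢ i → lookup x a ≡ 0
    off a a≢i with lookup x a in xₐ≡
    ... | zero  = refl
    ... | suc _ = ⊥-elim (∄a (a , subst (1 ≤_) (sym xₐ≡) (s≤s z≤n) , a≢i))

  walk-to-pile : ∀ i x → ∃[ m ] (m ≤ cost x i × Walk _~_ x (pile i) m)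
  walk-to-pile i x = go x (<-wellFounded (cost x i))
    where
    go : ∀ x → Acc _<_ (cost x i) → ∃[ m ] (m ≤ cost x i × Walk _~_ x (pile i) m)
    go x (acc rec) with descend i x
    ... | inj₁ refl = 0 , z≤n , here
    ... | inj₂ (y , x~y , y<x) with go y (rec y<x)
    ...   | m , m≤cost , walk = suc m , ℕ.≤-trans (s≤s m≤cost) y<x , step x~y walk

  cost-pile : ∀ i → cost (pile i) i ≡ 0
  cost-pile i = trans (dot-concentrated i k (λ j → D j i)) (trans (cong (k *_) (D-self i)) (ℕ.*-zeroʳ k))

  dist-to-pile : ∀ i x {m} → Dist _~_ x (pile i) m → m ≡ cost x i
  dist-to-pile i x {m} (walk , minimal) with walk-to-pile i x
  ... | m′ , m′≤cost , walk′ = ℕ.≤-antisym (ℕ.≤-trans (minimal m′ walk′) m′≤cost)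
    (subst (cost x i ≤_) (trans (cong (_+_ m) (cost-pile i)) (ℕ.+-identityʳ m)) (cost-walk i walk))

module RowSums where

  open TokenVectors using (dot)
  open import Data.Nat using (zero; suc; _+_; _*_; _<_; s≤s)
  import Data.Nat.Properties as ℕ
  open import Data.Fin using (zero; suc; toℕ; fromℕ<; punchIn)
  open import Data.Fin.Properties using (toℕ-fromℕ<; toℕ-injective; punchInᵢ≢i)
  open import Data.Vec using (Vec; []; _∷_)
  import Data.Vec as Vec
  open import Data.Bool using (if_then_else_)
  open import Function using (_∘_; const)
  open import Relation.Nullary using (does)
  open import Relation.Nullary.Decidable using (dec-true; dec-false)
  open import Relation.Binary.PropositionalEquality
  open import Algebra.Properties.Semiring.Sum ℕ.+-*-semiring
    using (sum; sum-syntax; sum-cong-≗; sum-remove; sum-replicate-zero; ∑-distrib-+; *-distribˡ-sum)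
  open ≡-Reasoning

  moment : (ℕ → ℕ) → ℕ → ℕ
  moment c B = ∑[ t < B ] (toℕ t * c (toℕ t))

  moment-cong : ∀ {c c′} B → (∀ t → c t ≡ c′ t) → moment c B ≡ moment c′ B
  moment-cong B c≐c′ = sum-cong-≗ {B} (λ t → cong (toℕ t *_) (c≐c′ (toℕ t)))

  moment-+ : ∀ c c′ B → moment (λ t → c t + c′ t) B ≡ moment c B + moment c′ B
  moment-+ c c′ B = trans (sum-cong-≗ {B} (λ t → ℕ.*-distribˡ-+ (toℕ t) (c (toℕ t)) (c′ (toℕ t))))
                          (∑-distrib-+ {B} (λ t → toℕ t * c (toℕ t)) (λ t → toℕ t * c′ (toℕ t)))

  indicator : ℕ → ℕ → ℕ
  indicator a t = if does (a ℕ.≟ t) then 1 else 0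

  moment-indicator : ∀ {B} a → a < B → moment (indicator a) B ≡ a
  moment-indicator {suc B} a a<B = begin
    ∑[ t < suc B ] f t                ≡⟨ sum-remove {i = p} f ⟩
    f p + ∑[ l < B ] f (punchIn p l)  ≡⟨ cong₂ _+_ fₚ≡a (trans (sum-cong-≗ off) (sum-replicate-zero B)) ⟩
    a + 0                             ≡⟨ ℕ.+-identityʳ a ⟩
    a                                 ∎
    where
    f : Fin (suc B) → ℕ
    f t = toℕ t * indicator a (toℕ t)
    p = fromℕ< a<B
    fₚ≡a : f p ≡ a
    fₚ≡a = begin
      toℕ p * indicator a (toℕ p)  ≡⟨ cong (λ t → t * indicator a t) (toℕ-fromℕ< a<B) ⟩
      a * indicator a a            ≡⟨ cong (λ b → a * (if b then 1 else 0)) (dec-true (a ℕ.≟ a) refl) ⟩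
      a * 1                        ≡⟨ ℕ.*-identityʳ a ⟩
      a                            ∎
    off : ∀ l → f (punchIn p l) ≡ 0
    off l = trans (cong (λ b → t * (if b then 1 else 0)) (dec-false (a ℕ.≟ t) a≢t)) (ℕ.*-zeroʳ t)
      where
      t = toℕ (punchIn p l)
      a≢t : a ≢ t
      a≢t a≡t = punchInᵢ≢i p l (toℕ-injective (trans (sym a≡t) (sym (toℕ-fromℕ< a<B))))

  sum≡moment-countFin : ∀ {n} (f : Fin n → ℕ) B → (∀ j → f j < B) → sum f ≡ moment (countFin f) B
  sum≡moment-countFin {zero}  f B _ =
    sym (trans (sum-cong-≗ {B} (ℕ.*-zeroʳ ∘ toℕ)) (sum-replicate-zero B))
  sum≡moment-countFin {suc n} f B f<B = begin
    f zero + sum (f ∘ suc)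
      ≡⟨ cong₂ _+_ (sym (moment-indicator (f zero) (f<B zero)))
                   (sum≡moment-countFin (f ∘ suc) B (f<B ∘ suc)) ⟩
    moment (indicator (f zero)) B + moment (countFin (f ∘ suc)) B
      ≡⟨ moment-+ (indicator (f zero)) (countFin (f ∘ suc)) B ⟨
    moment (countFin f) B
      ∎

  ≤-sum : ∀ {n} (f : Fin n → ℕ) j → f j ≤ sum f
  ≤-sum {suc n} f j = subst (f j ≤_) (sym (sum-remove {i = j} f)) (ℕ.m≤m+n (f j) _)

  degreeRegular⇒rowSums≡ : ∀ {n} (D : Fin n → Fin n → ℕ) → DegreeRegular D →
    ∀ u v → sum (D u) ≡ sum (D v)
  degreeRegular⇒rowSums≡ D regular u v = begin
    sum (D u)                  ≡⟨ sum≡moment-countFin (D u) B Du<B ⟩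
    moment (countFin (D u)) B  ≡⟨ moment-cong B (regular u v) ⟩
    moment (countFin (D v)) B  ≡⟨ sum≡moment-countFin (D v) B Dv<B ⟨
    sum (D v)                  ∎
    where
    B = suc (sum (D u) + sum (D v))
    Du<B : ∀ j → D u j < B
    Du<B j = s≤s (ℕ.≤-trans (≤-sum (D u) j) (ℕ.m≤m+n _ _))
    Dv<B : ∀ j → D v j < B
    Dv<B j = s≤s (ℕ.≤-trans (≤-sum (D v) j) (ℕ.m≤n+m _ _))

  ∑-dot : ∀ {n m} (x : Vec ℕ n) (F : Fin n → Fin m → ℕ) →
    ∑[ c < m ] dot x (λ j → F j c) ≡ dot x (λ j → sum (F j))
  ∑-dot {m = m} []      F = sum-replicate-zero m
  ∑-dot         (a ∷ x) F = begin
    ∑[ c < _ ] (a * F zero c + dot x (λ j → F (suc j) c))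
      ≡⟨ ∑-distrib-+ (λ c → a * F zero c) (λ c → dot x (λ j → F (suc j) c)) ⟩
    ∑[ c < _ ] (a * F zero c) + ∑[ c < _ ] dot x (λ j → F (suc j) c)
      ≡⟨ cong₂ _+_ (*-distribˡ-sum a (F zero)) (sym (∑-dot x (F ∘ suc))) ⟨
    a * sum (F zero) + dot x (λ j → sum (F (suc j)))
      ∎

  dot-const : ∀ {n} (x : Vec ℕ n) r → dot x (const r) ≡ Vec.sum x * r
  dot-const []      r = refl
  dot-const (a ∷ x) r = trans (cong (_+_ (a * r)) (dot-const x r)) (sym (ℕ.*-distribʳ-+ r a (Vec.sum x)))

module Nonsingular where

  import Data.Nat as ℕ
  open import Data.Fin using (zero; suc)
  open import Data.Integer using (ℤ; -_; _+_; _-_; _*_; 0ℤ)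
  import Data.Integer.Properties as ℤ
  open import Data.Integer.Tactic.RingSolver using (solve-∀)
  open import Algebra.Properties.Semiring.Sum ℤ.+-*-semiring
    using (sum-syntax; sum-cong-≗; ∑-distrib-+)
  open import Data.Vec using (Vec; []; _∷_; lookup; tabulate)
  open import Data.Vec.Properties using (tabulate∘lookup; tabulate-cong)
  open import Function using (_∘_)
  open import Relation.Binary.PropositionalEquality
  open ≡-Reasoning
  open Determinant using (∑-neg; det≢0⇒rows-independent)
  open TokenVectors using (dot)

  +dot≡∑ : ∀ {n} (x : Vec ℕ n) (w : Fin n → ℕ) → + dot x w ≡ ∑[ j < n ] (+ lookup x j * + w j)
  +dot≡∑ []      w = refl
  +dot≡∑ (a ∷ x) w = trans (ℤ.pos-+ (a ℕ.* w zero) (dot x (w ∘ suc)))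
                           (cong₂ _+_ (ℤ.pos-* a (w zero)) (+dot≡∑ x (w ∘ suc)))

  dot-injective : ∀ {n} (D : Fin n → Fin n → ℕ) → det (λ i j → + D i j) ≢ 0ℤ →
    ∀ u v → (∀ c → dot u (λ j → D j c) ≡ dot v (λ j → D j c)) → u ≡ v
  dot-injective {n} D det≢0 u v uD≡vD = begin
    u                    ≡⟨ tabulate∘lookup u ⟨
    tabulate (lookup u)  ≡⟨ tabulate-cong uⱼ≡vⱼ ⟩
    tabulate (lookup v)  ≡⟨ tabulate∘lookup v ⟩
    v                    ∎
    where
    w : Fin n → ℤ
    w j = + lookup u j - + lookup v j
    distrib : ∀ a b d → (a - b) * d ≡ a * d + - (b * d)
    distrib = solve-∀
    wD≡0 : ∀ c → ∑[ j < n ] (w j * + D j c) ≡ 0ℤ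
    wD≡0 c = begin
      ∑[ j < n ] (w j * + D j c)
        ≡⟨ sum-cong-≗ (λ j → distrib (+ lookup u j) (+ lookup v j) (+ D j c)) ⟩
      ∑[ j < n ] (+ lookup u j * + D j c + - (+ lookup v j * + D j c))
        ≡⟨ ∑-distrib-+ (λ j → + lookup u j * + D j c) (λ j → - (+ lookup v j * + D j c)) ⟩
      ∑[ j < n ] (+ lookup u j * + D j c) + ∑[ j < n ] (- (+ lookup v j * + D j c))
        ≡⟨ cong₂ _+_ (sym (+dot≡∑ u (λ j → D j c)))
                     (trans (∑-neg (λ j → + lookup v j * + D j c))
                            (cong -_ (sym (+dot≡∑ v (λ j → D j c))))) ⟩
      + dot u (λ j → D j c) - + dot v (λ j → D j c)
        ≡⟨ cong (λ t → + t - + dot v (λ j → D j c)) (uD≡vD c) ⟩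
      + dot v (λ j → D j c) - + dot v (λ j → D j c)
        ≡⟨ ℤ.+-inverseʳ (+ dot v (λ j → D j c)) ⟩
      0ℤ
        ∎
    uⱼ≡vⱼ : ∀ j → lookup u j ≡ lookup v j
    uⱼ≡vⱼ j = ℤ.+-injective (ℤ.i-j≡0⇒i≡j _ _
      (det≢0⇒rows-independent (λ i j → + D i j) det≢0 w wD≡0 j))

module Resolution {n} (G : Graph n) (D : Fin n → Fin n → ℕ) (D-dist : IsDistMatrix G D)
                  (D-nonsingular : det (λ i j → + D i j) ≢ + 0) (k : ℕ) where

  open import Data.Nat using (_*_)
  import Data.Nat.Properties as ℕ
  open import Data.List using (tabulate)
  open import Data.List.Properties using (length-tabulate)
  open import Data.List.Membership.Propositional.Properties using (∈-tabulate⁺)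
  import Data.Vec as Vec
  open import Data.Product using (_,_)
  open import Function using (const)
  open import Relation.Binary.PropositionalEquality
  open import Algebra.Properties.Semiring.Sum ℕ.+-*-semiring using (sum; sum-syntax)
  open TokenVectors using (dot; dot-cong)
  open Supertoken G D D-dist k public
  open Nonsingular using (dot-injective)
  open RowSums using (∑-dot; dot-const; degreeRegular⇒rowSums≡)
  open ≡-Reasoning

  cost-injective : ∀ u v → (∀ c → cost u c ≡ cost v c) → STEq u v
  cost-injective (x , _) (y , _) = dot-injective D D-nonsingular x y

  sameDist⇒sameCost : ∀ {u v} c → SameDist _~_ u v (pile c) → cost u c ≡ cost v c
  sameDist⇒sameCost {u} {v} c (_ , u-dist , v-dist) =
    trans (sym (dist-to-pile c u u-dist)) (dist-to-pile c v v-dist)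

  metricDim≤n : MetricDimLE STEq _~_ n
  metricDim≤n = tabulate pile , ℕ.≤-reflexive (length-tabulate pile) ,
    λ u v same → cost-injective u v (λ c → sameDist⇒sameCost c (same (∈-tabulate⁺ c)))

  ∑-cost : DegreeRegular D → ∀ r u → ∑[ c < n ] cost u c ≡ k * sum (D r)
  ∑-cost regular r (x , Σx≡k) = begin
    ∑[ c < n ] dot x (λ j → D j c)  ≡⟨ ∑-dot x D ⟩
    dot x (λ j → sum (D j))         ≡⟨ dot-cong x (λ j → degreeRegular⇒rowSums≡ D regular j r) ⟩
    dot x (const (sum (D r)))       ≡⟨ dot-const x (sum (D r)) ⟩
    Vec.sum x * sum (D r)           ≡⟨ cong (_* sum (D r)) Σx≡k ⟩
    k * sum (D r)                   ∎

open import Data.Nat using (zero; suc; _+_; z≤n)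
open import Data.Nat.Properties using (≤-reflexive; +-cancelʳ-≡; +-*-semiring)
open import Algebra.Properties.Semiring.Sum +-*-semiring using (sum-cong-≗)
open import Data.Fin using (zero; suc)
open import Data.Vec using ([])
open import Data.List using ([]; tabulate)
open import Data.List.Properties using (length-tabulate)
open import Data.List.Membership.Propositional.Properties using (∈-tabulate⁺)
open import Data.Product using (_,_)
open import Function using (_∘_)
open import Relation.Binary.PropositionalEquality using (_≡_; refl; sym; trans; cong)

metricDim≤n∸1 : ∀ {n} (G : Graph n) (D : Fin n → Fin n → ℕ) (D-dist : IsDistMatrix G D) →
  det (λ i j → + D i j) ≢ + 0 → (k : ℕ) → DegreeRegular D → MetricDimLE STEq (STAdj G k) (n ∸ 1)
metricDim≤n∸1 {zero}  G D D-dist D-nonsingular k regular = [] , z≤n , λ { ([] , _) ([] , _) _ → refl }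
metricDim≤n∸1 {suc n} G D D-dist D-nonsingular k regular =
  tabulate (pile ∘ suc) , ≤-reflexive (length-tabulate (pile ∘ suc)) , resolving
  where
  open Resolution G D D-dist D-nonsingular k
  resolving : Resolving STEq _~_ (tabulate (pile ∘ suc))
  resolving u v same = cost-injective u v agree
    where
    agree-suc : ∀ c → cost u (suc c) ≡ cost v (suc c)
    agree-suc c = sameDist⇒sameCost (suc c) (same (∈-tabulate⁺ c))
    -- The costs at vertex 0 are recovered from their common total k · (row sum of D).
    agree : ∀ c → cost u c ≡ cost v c
    agree zero = +-cancelʳ-≡ _ (cost u zero) (cost v zero)
      (trans (cong (_+_ (cost u zero)) (sym (sum-cong-≗ agree-suc)))
             (trans (∑-cost regular zero u) (sym (∑-cost regular zero v))))
    agree (suc c) = agree-suc c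

mainTheorem11 : (n : ℕ) (G : Graph n) → Connected (E G) →
    (D : Fin n → Fin n → ℕ) → IsDistMatrix G D →
    det (λ i j → + (D i j)) ≢ + 0 →
    (k : ℕ) → 1 ≤ k →
    MetricDimLE STEq (STAdj G k) n
    × (DegreeRegular D → MetricDimLE STEq (STAdj G k) (n ∸ 1))
mainTheorem11 n G _ D D-dist D-nonsingular k _ =
  Resolution.metricDim≤n G D D-dist D-nonsingular k , metricDim≤n∸1 G D D-dist D-nonsingular k
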